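{- Let $h\ge0$, $m=2h+1$, $q=3^m$, $\alpha=3^{h+1}$, $f_a(x)=x^{2\alpha+3}+(ax)^{\alpha}-a^2x$ for $a\in\mathbb{F}_q$, and $D_a=\{f_a(x^2)\mid x\in\mathbb{F}_q^*\}$ for $a\in\mathbb{F}_q^*$. Then for every $a\in\mathbb{F}_q^*$, the difference set $D_a$ in $(\mathbb{F}_q,+)$ is equivalent to $D_1$ or to $D_{ -1}$.
   Context: Two difference sets $D_1',D_2'$ in an abelian group $G$ (written additively) are equivalent if there exist an automorphism $\sigma$ of $G$ and $g\in G$ with $\sigma(D_1')=D_2'+g$. For $a\in\mathbb{F}_q^*$, $D_a$ is a skew Hadamard difference set in $(\mathbb{F}_q,+)$. -}

module Defs where

open import Level using (0ℓ)
open import Data.Nat using (ℕ; zero; suc) renaming (_+_ to _+ℕ_; _*_ to _*ℕ_; _^_ to _^ℕ_)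
open import Data.Fin using (Fin)
open import Data.Product using (Σ; _×_; ∃; _,_)
open import Relation.Binary.PropositionalEquality using (_≡_)
open import Relation.Nullary using (¬_)
open import Function.Bundles using (_↔_; Inverse)
open import Algebra.Structures using (IsCommutativeRing)

-- A finite field with exactly q elements: a commutative ring (with propositional
-- equality) in which 1 ≠ 0 and every nonzero element has a multiplicative inverse,
-- whose carrier is in bijection with Fin q.  (Any such field is F_q up to isomorphism.)
record FiniteField (q : ℕ) : Set₁ where
  infixl 6 _+_
  infixl 7 _*_
  field
    Carrier : Set
    _+_ _*_ : Carrier → Carrier → Carrier
    -_      : Carrier → Carrier
    0# 1#   : Carrier
    isCommutativeRing : IsCommutativeRing _≡_ _+_ _*_ -_ 0# 1#
    0≢1     : ¬ (0# ≡ 1#)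
    inverse : ∀ x → ¬ (x ≡ 0#) → Σ Carrier λ y → x * y ≡ 1#
    enumeration : Carrier ↔ Fin q

  _-_ : Carrier → Carrier → Carrier
  x - y = x + (- y)

  _^_ : Carrier → ℕ → Carrier
  x ^ zero  = 1#
  x ^ suc n = x * (x ^ n)

  Subset : Set₁
  Subset = Carrier → Set

  record AddAut : Set where
    field
      perm : Carrier ↔ Carrier
      hom  : ∀ x y → Inverse.to perm (x + y) ≡ Inverse.to perm x + Inverse.to perm y

  -- D₁' and D₂' are equivalent: σ(D₁') = D₂' + g for some additive automorphism σ and g ∈ F
  Equivalent : Subset → Subset → Set
  Equivalent D₁ D₂ =
    Σ AddAut λ σ → Σ Carrier λ g → ∀ z →
      ((Σ Carrier λ d → D₁ d × Inverse.to (AddAut.perm σ) d ≡ z)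
        → (Σ Carrier λ d → D₂ d × (d + g) ≡ z))
      × ((Σ Carrier λ d → D₂ d × (d + g) ≡ z)
        → (Σ Carrier λ d → D₁ d × Inverse.to (AddAut.perm σ) d ≡ z))

m′ : ℕ → ℕ
m′ h = suc (2 *ℕ h)

q′ : ℕ → ℕ
q′ h = 3 ^ℕ m′ h

α′ : ℕ → ℕ
α′ h = 3 ^ℕ suc h

module _ (h : ℕ) (F : FiniteField (q′ h)) where
  open FiniteField F

  f : Carrier → Carrier → Carrier
  f a x = ((x ^ (2 *ℕ α′ h +ℕ 3)) + ((a * x) ^ α′ h)) - ((a ^ 2) * x)

  D : Carrier → Subset
  D a y = Σ Carrier λ x → ¬ (x ≡ 0#) × f a (x ^ 2) ≡ y

{-# OPTIONS --safe #-}
module Submission where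

-- Write q = 2n + 1; as q ≡ 3 (mod 4), n is odd.  For a ≠ 0 the quadratic character s = aⁿ
-- is ±1 and t = s·a satisfies tⁿ = 1.  Since α² = 3q, the number 2(α+1) is invertible
-- modulo n, so t = λ^(α+1) for a nonzero square λ = μ², i.e. a = s·λ^(α+1).  Fermat gives
-- λ^(α²) = λ³, whence f_a(λy) = λ^(2α+3)·f_s(y): the substitution x ↦ μx carries D_a onto
-- λ^(2α+3)·D_s, and multiplication by λ^-(2α+3) is an additive automorphism.

open import Level using (0ℓ)
open import Data.Nat as ℕ using (ℕ; zero; suc)
open import Data.Fin as Fin using (Fin)
import Data.Fin.Properties as Fin
import Data.Nat.Properties as ℕ
open import Data.Vec.Functional using (replicate)
open import Data.Product using (Σ; _×_; ∃; ∃₂; _,_; proj₁; proj₂)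
open import Data.Sum using (_⊎_; inj₁; inj₂)
open import Data.Empty using (⊥-elim)
open import Function.Base using (_∘_; case_of_)
open import Function.Bundles using (_↔_; Inverse; mk↔ₛ′)
open import Function.Construct.Composition using (_↔-∘_)
open import Function.Construct.Symmetry using (↔-sym)
open import Function.Properties.Inverse using (↔⇒↣)
open import Relation.Binary.Definitions using (DecidableEquality)
open import Relation.Binary.PropositionalEquality
open import Relation.Nullary using (¬_; Dec; yes; no)
open import Relation.Nullary.Decidable using (via-injection)
open import Algebra.Bundles using (CommutativeRing)
open import Algebra.Structures using (IsCommutativeRing)
import Algebra.Properties.CommutativeSemiring.Exp as Exp
import Algebra.Properties.CommutativeMonoid.Sum as Sum
import Algebra.Properties.Group as GroupProperties
import Algebra.Properties.Ring as RingProperties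
open import Data.Nat.Tactic.RingSolver using (solve-∀)
open import Defs

module Arithmetic where
  open import Data.Nat
  open import Data.Nat.Properties
  open import Data.Nat.Tactic.RingSolver using (solve)
  open import Data.List using (_∷_; [])
  open ≡-Reasoning

  3^n-odd : ∀ n → ∃ λ r → 3 ^ n ≡ suc (2 * r)
  3^n-odd zero    = 0 , refl
  3^n-odd (suc n) with 3^n-odd n
  ... | r , 3^n≡1+2r = 3 * r + 1 , (begin
    3 * 3 ^ n              ≡⟨ cong (3 *_) 3^n≡1+2r ⟩
    3 * suc (2 * r)        ≡⟨ solve (r ∷ []) ⟩
    suc (2 * (3 * r + 1))  ∎)

  q′≡4k+3 : ∀ h → ∃ λ k → q′ h ≡ 4 * k + 3
  q′≡4k+3 zero    = 0 , refl
  q′≡4k+3 (suc h) with q′≡4k+3 h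
  ... | k , q′h≡4k+3 = 9 * k + 6 , (begin
    3 ^ suc (2 * suc h)    ≡⟨ cong (λ e → 3 ^ suc e) (*-suc 2 h) ⟩
    3 * (3 * q′ h)         ≡⟨ cong (λ x → 3 * (3 * x)) q′h≡4k+3 ⟩
    3 * (3 * (4 * k + 3))  ≡⟨ solve (k ∷ []) ⟩
    4 * (9 * k + 6) + 3    ∎)

  α′²≡3q′ : ∀ h → α′ h * α′ h ≡ 3 * q′ h
  α′²≡3q′ h = begin
    3 ^ suc h * 3 ^ suc h  ≡⟨ ^-distribˡ-+-* 3 (suc h) (suc h) ⟨
    3 ^ (suc h + suc h)    ≡⟨ cong (3 ^_) (1+h+[1+h]≡2+2h h) ⟩
    3 ^ suc (suc (2 * h))  ∎
    where
    1+h+[1+h]≡2+2h : ∀ h → suc h + suc h ≡ suc (suc (2 * h))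
    1+h+[1+h]≡2+2h = solve-∀

  2[α+1]-inverse : ∀ k r → suc (2 * r) * suc (2 * r) ≡ 3 * (4 * k + 3) →
                   suc k * r * (2 * suc (suc (2 * r))) ≡ suc (suc (2 * k) * (6 * k + 7))
  2[α+1]-inverse k r α²≡3q = begin
    suc k * r * (2 * suc (suc (2 * r)))  ≡⟨ solve (k ∷ r ∷ []) ⟩
    4 * suc k * (r * r + r)              ≡⟨ cong (4 * suc k *_) r²+r≡3k+2 ⟩
    4 * suc k * (3 * k + 2)              ≡⟨ solve (k ∷ []) ⟩
    suc (suc (2 * k) * (6 * k + 7))      ∎
    where
    r²+r≡3k+2 : r * r + r ≡ 3 * k + 2
    r²+r≡3k+2 = *-cancelˡ-≡ _ _ 4 (suc-injective (begin
      suc (4 * (r * r + r))      ≡⟨ solve (r ∷ []) ⟩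
      suc (2 * r) * suc (2 * r)  ≡⟨ α²≡3q ⟩
      3 * (4 * k + 3)            ≡⟨ solve (k ∷ []) ⟩
      suc (4 * (3 * k + 2))      ∎))

  -- With α = 2r + 1, α² = 3q ≡ 3 (mod n) gives (α+1)(α-1) ≡ 2, and k + 1 halves modulo n.
  2[α′+1]-invertible : ∀ h k → q′ h ≡ 4 * k + 3 →
                       ∃₂ λ e j → e * (2 * suc (α′ h)) ≡ suc (suc (2 * k) * j)
  2[α′+1]-invertible h k q′h≡4k+3 with 3^n-odd (suc h)
  ... | r , α′h≡1+2r = suc k * r , 6 * k + 7 , (begin
    suc k * r * (2 * suc (α′ h))         ≡⟨ cong (λ α → suc k * r * (2 * suc α)) α′h≡1+2r ⟩
    suc k * r * (2 * suc (suc (2 * r)))  ≡⟨ 2[α+1]-inverse k r [1+2r]²≡3[4k+3] ⟩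
    suc (suc (2 * k) * (6 * k + 7))      ∎)
    where
    [1+2r]²≡3[4k+3] : suc (2 * r) * suc (2 * r) ≡ 3 * (4 * k + 3)
    [1+2r]²≡3[4k+3] = begin
      suc (2 * r) * suc (2 * r)  ≡⟨ cong₂ _*_ α′h≡1+2r α′h≡1+2r ⟨
      α′ h * α′ h                ≡⟨ α′²≡3q′ h ⟩
      3 * q′ h                   ≡⟨ cong (3 *_) q′h≡4k+3 ⟩
      3 * (4 * k + 3)            ∎

open Arithmetic using (q′≡4k+3; α′²≡3q′; 2[α′+1]-invertible)

module FieldProperties {q : ℕ} (F : FiniteField q) where
  open FiniteField F
  open IsCommutativeRing isCommutativeRing hiding (refl; sym; trans; reflexive; _-_)
  open ≡-Reasoning

  ring : CommutativeRing 0ℓ 0ℓ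
  ring = record { isCommutativeRing = isCommutativeRing }

  module Pow = Exp (CommutativeRing.commutativeSemiring ring)

  private
    module +-Group = GroupProperties (CommutativeRing.+-group ring)

  infix 4 _≟_
  _≟_ : DecidableEquality Carrier
  _≟_ = via-injection (↔⇒↣ enumeration) Fin._≟_

  inv : (x : Carrier) → x ≢ 0# → Carrier
  inv x x≢0 = proj₁ (inverse x x≢0)

  module _ {x : Carrier} (x≢0 : x ≢ 0#) where

    x*x⁻¹≡1 : x * inv x x≢0 ≡ 1#
    x*x⁻¹≡1 = proj₂ (inverse x x≢0)

    x⁻¹*x≡1 : inv x x≢0 * x ≡ 1#
    x⁻¹*x≡1 = trans (*-comm _ x) x*x⁻¹≡1

    x⁻¹≢0 : inv x x≢0 ≢ 0#
    x⁻¹≢0 x⁻¹≡0 = 0≢1 (begin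
      0#             ≡⟨ zeroʳ x ⟨
      x * 0#         ≡⟨ cong (x *_) x⁻¹≡0 ⟨
      x * inv x x≢0  ≡⟨ x*x⁻¹≡1 ⟩
      1#             ∎)

    x⁻¹*[x*y]≡y : ∀ y → inv x x≢0 * (x * y) ≡ y
    x⁻¹*[x*y]≡y y = begin
      inv x x≢0 * (x * y)  ≡⟨ *-assoc _ x y ⟨
      inv x x≢0 * x * y    ≡⟨ cong (_* y) x⁻¹*x≡1 ⟩
      1# * y               ≡⟨ *-identityˡ y ⟩
      y                    ∎

    x*[x⁻¹*y]≡y : ∀ y → x * (inv x x≢0 * y) ≡ y
    x*[x⁻¹*y]≡y y = begin
      x * (inv x x≢0 * y)  ≡⟨ *-assoc x _ y ⟨
      x * inv x x≢0 * y    ≡⟨ cong (_* y) x*x⁻¹≡1 ⟩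
      1# * y               ≡⟨ *-identityˡ y ⟩
      y                    ∎

    *-cancelˡ : ∀ {y z} → x * y ≡ x * z → y ≡ z
    *-cancelˡ {y} {z} xy≡xz = begin
      y                    ≡⟨ x⁻¹*[x*y]≡y y ⟨
      inv x x≢0 * (x * y)  ≡⟨ cong (inv x x≢0 *_) xy≡xz ⟩
      inv x x≢0 * (x * z)  ≡⟨ x⁻¹*[x*y]≡y z ⟩
      z                    ∎

    x*y≢0 : ∀ {y} → y ≢ 0# → x * y ≢ 0#
    x*y≢0 {y} y≢0 xy≡0 = y≢0 (*-cancelˡ (trans xy≡0 (sym (zeroʳ x))))

    *-↔ : Carrier ↔ Carrier
    *-↔ = mk↔ₛ′ (x *_) (inv x x≢0 *_) x*[x⁻¹*y]≡y x⁻¹*[x*y]≡y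

    *-AddAut : AddAut
    *-AddAut = record { perm = *-↔ ; hom = distribˡ x }

  ^≡Pow^ : ∀ x n → x ^ n ≡ x Pow.^ n
  ^≡Pow^ x zero    = refl
  ^≡Pow^ x (suc n) = cong (x *_) (^≡Pow^ x n)

  ^-homo-* : ∀ x m n → x ^ (m ℕ.+ n) ≡ x ^ m * x ^ n
  ^-homo-* x m n = begin
    x ^ (m ℕ.+ n)          ≡⟨ ^≡Pow^ x (m ℕ.+ n) ⟩
    x Pow.^ (m ℕ.+ n)      ≡⟨ Pow.^-homo-* x m n ⟩
    x Pow.^ m * x Pow.^ n  ≡⟨ cong₂ _*_ (^≡Pow^ x m) (^≡Pow^ x n) ⟨
    x ^ m * x ^ n          ∎

  ^-assocʳ : ∀ x m n → (x ^ m) ^ n ≡ x ^ (m ℕ.* n)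
  ^-assocʳ x m n = begin
    (x ^ m) ^ n            ≡⟨ ^≡Pow^ (x ^ m) n ⟩
    (x ^ m) Pow.^ n        ≡⟨ cong (Pow._^ n) (^≡Pow^ x m) ⟩
    (x Pow.^ m) Pow.^ n    ≡⟨ Pow.^-assocʳ x m n ⟩
    x Pow.^ (m ℕ.* n)      ≡⟨ ^≡Pow^ x (m ℕ.* n) ⟨
    x ^ (m ℕ.* n)          ∎

  ^-distrib-* : ∀ x y n → (x * y) ^ n ≡ x ^ n * y ^ n
  ^-distrib-* x y n = begin
    (x * y) ^ n            ≡⟨ ^≡Pow^ (x * y) n ⟩
    (x * y) Pow.^ n        ≡⟨ Pow.^-distrib-* x y n ⟩
    x Pow.^ n * y Pow.^ n  ≡⟨ cong₂ _*_ (^≡Pow^ x n) (^≡Pow^ y n) ⟨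
    x ^ n * y ^ n          ∎

  1^n≡1 : ∀ n → 1# ^ n ≡ 1#
  1^n≡1 zero    = refl
  1^n≡1 (suc n) = trans (*-identityˡ _) (1^n≡1 n)

  x^n≢0 : ∀ {x} n → x ≢ 0# → x ^ n ≢ 0#
  x^n≢0 zero    x≢0 = 0≢1 ∘ sym
  x^n≢0 (suc n) x≢0 = x*y≢0 x≢0 (x^n≢0 n x≢0)

  x^n≡1⇒x^[1+nj]≡x : ∀ {x} n → x ^ n ≡ 1# → ∀ j → x ^ suc (n ℕ.* j) ≡ x
  x^n≡1⇒x^[1+nj]≡x {x} n x^n≡1 j = begin
    x * x ^ (n ℕ.* j)  ≡⟨ cong (x *_) (^-assocʳ x n j) ⟨
    x * (x ^ n) ^ j    ≡⟨ cong (λ y → x * y ^ j) x^n≡1 ⟩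
    x * 1# ^ j         ≡⟨ cong (x *_) (1^n≡1 j) ⟩
    x * 1#             ≡⟨ *-identityʳ x ⟩
    x                  ∎

  x²≡1⇒x≡±1 : ∀ {x} → x * x ≡ 1# → x ≡ 1# ⊎ x ≡ - 1#
  x²≡1⇒x≡±1 {x} x²≡1 with x + 1# ≟ 0#
  ... | yes x+1≡0 = inj₂ (+-Group.inverseˡ-unique x 1# x+1≡0)
  ... | no  x+1≢0 = inj₁ (+-Group.x∙y⁻¹≈ε⇒x≈y x 1# (*-cancelˡ x+1≢0 (begin
    (x + 1#) * (x - 1#)                ≡⟨ RingProperties.x[y-z]≈xy-xz (CommutativeRing.ring ring) _ x 1# ⟩
    ((x + 1#) * x) - ((x + 1#) * 1#)   ≡⟨ cong₂ _-_ (distribʳ x x 1#) (*-identityʳ _) ⟩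
    (x * x + 1# * x) - (x + 1#)        ≡⟨ cong₂ (λ u v → (u + v) - (x + 1#)) x²≡1 (*-identityˡ x) ⟩
    (1# + x) - (x + 1#)                ≡⟨ cong (_- (x + 1#)) (+-comm 1# x) ⟩
    (x + 1#) - (x + 1#)                ≡⟨ -‿inverseʳ _ ⟩
    0#                                 ≡⟨ zeroʳ _ ⟨
    (x + 1#) * 0#                      ∎)))

module Fermat {q : ℕ} (F : FiniteField q) where
  open FiniteField F
  open IsCommutativeRing isCommutativeRing hiding (refl; sym; trans; reflexive; _-_)
  open FieldProperties F
  open Sum (CommutativeRing.*-commutativeMonoid ring)
    using (sum-remove; sum-permute; sum-cong-≗; ∑-distrib-+; sum-replicate)
    renaming (sum to ∏)
  open ≡-Reasoning

  ⌊_⌋ : Carrier → Carrier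
  ⌊ x ⌋ with x ≟ 0#
  ... | yes _ = 1#
  ... | no  _ = x

  ⌊x⌋≢0 : ∀ x → ⌊ x ⌋ ≢ 0#
  ⌊x⌋≢0 x with x ≟ 0#
  ... | yes _   = 0≢1 ∘ sym
  ... | no  x≢0 = x≢0

  ∏≢0 : ∀ {n} (g : Fin n → Carrier) → (∀ i → g i ≢ 0#) → ∏ g ≢ 0#
  ∏≢0 {zero}  g g≢0 = 0≢1 ∘ sym
  ∏≢0 {suc n} g g≢0 = x*y≢0 (g≢0 Fin.zero) (∏≢0 (g ∘ Fin.suc) (g≢0 ∘ Fin.suc))

  module _ {p : ℕ} (enum : Carrier ↔ Fin (suc p)) {a : Carrier} (a≢0 : a ≢ 0#) where
    private
      E = Inverse.from enum
      T = Inverse.to enum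

    a-or-1 : Carrier → Carrier
    a-or-1 x with x ≟ 0#
    ... | yes _ = 1#
    ... | no  _ = a

    ⌊a*x⌋≡a-or-1*⌊x⌋ : ∀ x → ⌊ a * x ⌋ ≡ a-or-1 x * ⌊ x ⌋
    ⌊a*x⌋≡a-or-1*⌊x⌋ x with x ≟ 0# | a * x ≟ 0#
    ... | yes _   | yes _     = sym (*-identityˡ 1#)
    ... | yes x≡0 | no  ax≢0  = ⊥-elim (ax≢0 (trans (cong (a *_) x≡0) (zeroʳ a)))
    ... | no  x≢0 | yes ax≡0  = ⊥-elim (x*y≢0 a≢0 x≢0 ax≡0)
    ... | no  _   | no  _     = refl

    ∏a-or-1≡a^p : ∏ (a-or-1 ∘ E) ≡ a ^ p
    ∏a-or-1≡a^p = begin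
      ∏ (a-or-1 ∘ E)                                   ≡⟨ sum-remove {i = T 0#} (a-or-1 ∘ E) ⟩
      a-or-1 (E (T 0#)) * ∏ (a-or-1 ∘ E ∘ Fin.punchIn (T 0#))
        ≡⟨ cong₂ _*_ a-or-1[0]≡1 (sum-cong-≗ a-or-1[≢0]≡a) ⟩
      1# * ∏ (replicate p a)                           ≡⟨ *-identityˡ _ ⟩
      ∏ (replicate p a)                                ≡⟨ sum-replicate p ⟩
      a Pow.^ p                                        ≡⟨ ^≡Pow^ a p ⟨
      a ^ p                                            ∎
      where
      a-or-1[0]≡1 : a-or-1 (E (T 0#)) ≡ 1#
      a-or-1[0]≡1 rewrite Inverse.strictlyInverseʳ enum 0# with 0# ≟ 0#
      ... | yes _   = refl
      ... | no  0≢0 = ⊥-elim (0≢0 refl)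
      a-or-1[≢0]≡a : ∀ j → a-or-1 (E (Fin.punchIn (T 0#) j)) ≡ a
      a-or-1[≢0]≡a j with E (Fin.punchIn (T 0#) j) ≟ 0#
      ... | yes E≡0 = ⊥-elim (Fin.punchInᵢ≢i (T 0#) j
                        (trans (sym (Inverse.strictlyInverseˡ enum _)) (cong T E≡0)))
      ... | no  _   = refl

    -- x ↦ a·x permutes F and fixes 0, so it rescales the nonzero product ∏ ⌊x⌋ by a^(q-1).
    ∏⌊E⌋≡a^p*∏⌊E⌋ : ∏ (⌊_⌋ ∘ E) ≡ a ^ p * ∏ (⌊_⌋ ∘ E)
    ∏⌊E⌋≡a^p*∏⌊E⌋ = begin
      ∏ (⌊_⌋ ∘ E)                          ≡⟨ sum-permute (⌊_⌋ ∘ E) (enum ↔-∘ (*-↔ a≢0 ↔-∘ ↔-sym enum)) ⟩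
      ∏ (λ i → ⌊ E (T (a * E i)) ⌋)        ≡⟨ sum-cong-≗ (cong ⌊_⌋ ∘ Inverse.strictlyInverseʳ enum ∘ (a *_) ∘ E) ⟩
      ∏ (λ i → ⌊ a * E i ⌋)                ≡⟨ sum-cong-≗ (⌊a*x⌋≡a-or-1*⌊x⌋ ∘ E) ⟩
      ∏ (λ i → a-or-1 (E i) * ⌊ E i ⌋)     ≡⟨ ∑-distrib-+ (a-or-1 ∘ E) (⌊_⌋ ∘ E) ⟩
      ∏ (a-or-1 ∘ E) * ∏ (⌊_⌋ ∘ E)         ≡⟨ cong (_* ∏ (⌊_⌋ ∘ E)) ∏a-or-1≡a^p ⟩
      a ^ p * ∏ (⌊_⌋ ∘ E)                  ∎

    a^p≡1 : a ^ p ≡ 1#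
    a^p≡1 = *-cancelˡ (∏≢0 (⌊_⌋ ∘ E) (⌊x⌋≢0 ∘ E)) (begin
      P * a ^ p   ≡⟨ *-comm P _ ⟩
      a ^ p * P   ≡⟨ ∏⌊E⌋≡a^p*∏⌊E⌋ ⟨
      P           ≡⟨ *-identityʳ P ⟨
      P * 1#      ∎)
      where P = ∏ (⌊_⌋ ∘ E)

  fermat : ∀ {p} → q ≡ suc p → ∀ {a} → a ≢ 0# → a ^ p ≡ 1#
  fermat q≡1+p = a^p≡1 (subst (λ n → Carrier ↔ Fin n) q≡1+p enumeration)

  x^q≡x : ∀ {p} → q ≡ suc p → ∀ x → x ^ q ≡ x
  x^q≡x {p} q≡1+p x = trans (cong (x ^_) q≡1+p) (x*x^p≡x (x ≟ 0#))
    where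
    x*x^p≡x : Dec (x ≡ 0#) → x * x ^ p ≡ x
    x*x^p≡x (yes refl) = zeroˡ _
    x*x^p≡x (no  x≢0)  = trans (cong (x *_) (fermat q≡1+p x≢0)) (*-identityʳ x)

module Normalisation (h : ℕ) (F : FiniteField (q′ h)) where
  open FiniteField F
  open IsCommutativeRing isCommutativeRing hiding (refl; sym; trans; reflexive; _-_)
  open FieldProperties F
  open Fermat F using (fermat; x^q≡x)
  open ≡-Reasoning

  private
    α = α′ h
    k = proj₁ (q′≡4k+3 h)
    n = suc (2 ℕ.* k)

  q′≡1+[n+n] : q′ h ≡ suc (n ℕ.+ n)
  q′≡1+[n+n] = trans (proj₂ (q′≡4k+3 h)) (4k+3≡1+[n+n] k)
    where
    4k+3≡1+[n+n] : ∀ k → 4 ℕ.* k ℕ.+ 3 ≡ suc (suc (2 ℕ.* k) ℕ.+ suc (2 ℕ.* k))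
    4k+3≡1+[n+n] = solve-∀

  x^[α²]≡x³ : ∀ x → x ^ (α ℕ.* α) ≡ x ^ 3
  x^[α²]≡x³ x = begin
    x ^ (α ℕ.* α)      ≡⟨ cong (x ^_) (trans (α′²≡3q′ h) (ℕ.*-comm 3 (q′ h))) ⟩
    x ^ (q′ h ℕ.* 3)   ≡⟨ ^-assocʳ x (q′ h) 3 ⟨
    (x ^ q′ h) ^ 3     ≡⟨ cong (_^ 3) (x^q≡x q′≡1+[n+n] x) ⟩
    x ^ 3              ∎

  module _ (s u : Carrier) where
    private
      c = u ^ (2 ℕ.* α ℕ.+ 3)

    [su^[α+1]*u]^α≡c*s^α : (s * u ^ suc α * u) ^ α ≡ c * s ^ α
    [su^[α+1]*u]^α≡c*s^α = begin
      (s * u ^ suc α * u) ^ α                   ≡⟨ cong (_^ α) (trans (*-assoc s _ u) (cong (s *_) (*-comm _ u))) ⟩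
      (s * u ^ (2 ℕ.+ α)) ^ α                   ≡⟨ ^-distrib-* s _ α ⟩
      s ^ α * (u ^ (2 ℕ.+ α)) ^ α               ≡⟨ cong (s ^ α *_) (^-assocʳ u (2 ℕ.+ α) α) ⟩
      s ^ α * u ^ ((2 ℕ.+ α) ℕ.* α)             ≡⟨ cong (λ e → s ^ α * u ^ e) ([2+α]α≡αα+2α α) ⟩
      s ^ α * u ^ (α ℕ.* α ℕ.+ 2 ℕ.* α)         ≡⟨ cong (s ^ α *_) (^-homo-* u (α ℕ.* α) (2 ℕ.* α)) ⟩
      s ^ α * (u ^ (α ℕ.* α) * u ^ (2 ℕ.* α))   ≡⟨ cong (λ v → s ^ α * (v * u ^ (2 ℕ.* α))) (x^[α²]≡x³ u) ⟩
      s ^ α * (u ^ 3 * u ^ (2 ℕ.* α))           ≡⟨ cong (s ^ α *_) (^-homo-* u 3 (2 ℕ.* α)) ⟨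
      s ^ α * u ^ (3 ℕ.+ 2 ℕ.* α)               ≡⟨ cong (λ e → s ^ α * u ^ e) (ℕ.+-comm 3 (2 ℕ.* α)) ⟩
      s ^ α * c                                 ≡⟨ *-comm _ c ⟩
      c * s ^ α                                 ∎
      where
      [2+α]α≡αα+2α : ∀ α → (2 ℕ.+ α) ℕ.* α ≡ α ℕ.* α ℕ.+ 2 ℕ.* α
      [2+α]α≡αα+2α = solve-∀

    [su^[α+1]]²u≡c*s² : (s * u ^ suc α) ^ 2 * u ≡ c * s ^ 2
    [su^[α+1]]²u≡c*s² = begin
      (s * u ^ suc α) ^ 2 * u          ≡⟨ cong (_* u) (^-distrib-* s _ 2) ⟩
      s ^ 2 * (u ^ suc α) ^ 2 * u      ≡⟨ *-assoc _ _ u ⟩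
      s ^ 2 * ((u ^ suc α) ^ 2 * u)    ≡⟨ cong (λ v → s ^ 2 * (v * u)) (^-assocʳ u (suc α) 2) ⟩
      s ^ 2 * (u ^ (suc α ℕ.* 2) * u)  ≡⟨ cong (s ^ 2 *_) (*-comm _ u) ⟩
      s ^ 2 * u ^ suc (suc α ℕ.* 2)    ≡⟨ cong (λ e → s ^ 2 * u ^ e) (1+[1+α]2≡2α+3 α) ⟩
      s ^ 2 * c                        ≡⟨ *-comm _ c ⟩
      c * s ^ 2                        ∎
      where
      1+[1+α]2≡2α+3 : ∀ α → suc (suc α ℕ.* 2) ≡ 2 ℕ.* α ℕ.+ 3
      1+[1+α]2≡2α+3 = solve-∀

    f-scaling : ∀ y → f h F (s * u ^ suc α) (u * y) ≡ c * f h F s y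
    f-scaling y = begin
      ((u * y) ^ A + (a * (u * y)) ^ α) - (a ^ 2 * (u * y))
        ≡⟨ cong₂ _-_ (cong₂ _+_ (^-distrib-* u y A)
                                (trans (cong (_^ α) (sym (*-assoc a u y))) (^-distrib-* (a * u) y α)))
                     (sym (*-assoc _ u y)) ⟩
      (c * y ^ A + (a * u) ^ α * y ^ α) - (a ^ 2 * u * y)
        ≡⟨ cong₂ (λ v w → (c * y ^ A + v * y ^ α) - (w * y)) [su^[α+1]*u]^α≡c*s^α [su^[α+1]]²u≡c*s² ⟩
      (c * y ^ A + c * s ^ α * y ^ α) - (c * s ^ 2 * y)
        ≡⟨ cong₂ (λ v w → (c * y ^ A + v) - w) (trans (*-assoc c _ _) (cong (c *_) (sym (^-distrib-* s y α))))
                                               (*-assoc c _ y) ⟩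
      (c * y ^ A + c * (s * y) ^ α) - (c * (s ^ 2 * y))
        ≡⟨ cong (_- (c * (s ^ 2 * y))) (distribˡ c _ _) ⟨
      (c * (y ^ A + (s * y) ^ α)) - (c * (s ^ 2 * y))
        ≡⟨ RingProperties.x[y-z]≈xy-xz (CommutativeRing.ring ring) c _ _ ⟨
      c * ((y ^ A + (s * y) ^ α) - (s ^ 2 * y))
        ∎
      where
      A = 2 ℕ.* α ℕ.+ 3
      a = s * u ^ suc α

  D-equivalent-by-scaling : ∀ {a b μ c} → μ ≢ 0# → c ≢ 0# →
                            (∀ y → f h F a (μ ^ 2 * y) ≡ c * f h F b y) →
                            Equivalent (D h F a) (D h F b)
  D-equivalent-by-scaling {a} {b} {μ} {c} μ≢0 c≢0 f-scaled =
    *-AddAut (x⁻¹≢0 c≢0) , 0# , λ z → forward z , backward z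
    where
    c⁻¹ = inv c c≢0
    μ⁻¹ = inv μ μ≢0

    f[[μw]²]≡c*f[w²] : ∀ w → f h F a ((μ * w) ^ 2) ≡ c * f h F b (w ^ 2)
    f[[μw]²]≡c*f[w²] w = trans (cong (f h F a) (^-distrib-* μ w 2)) (f-scaled (w ^ 2))

    forward : ∀ z → Σ Carrier (λ d → D h F a d × c⁻¹ * d ≡ z) → Σ Carrier (λ d → D h F b d × d + 0# ≡ z)
    forward z (d , (x , x≢0 , f[x²]≡d) , c⁻¹d≡z) =
      z , (μ⁻¹ * x , x*y≢0 (x⁻¹≢0 μ≢0) x≢0 , (begin
        f h F b ((μ⁻¹ * x) ^ 2)               ≡⟨ x⁻¹*[x*y]≡y c≢0 _ ⟨
        c⁻¹ * (c * f h F b ((μ⁻¹ * x) ^ 2))   ≡⟨ cong (c⁻¹ *_) (f[[μw]²]≡c*f[w²] (μ⁻¹ * x)) ⟨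
        c⁻¹ * f h F a ((μ * (μ⁻¹ * x)) ^ 2)   ≡⟨ cong (λ w → c⁻¹ * f h F a (w ^ 2)) (x*[x⁻¹*y]≡y μ≢0 x) ⟩
        c⁻¹ * f h F a (x ^ 2)                 ≡⟨ cong (c⁻¹ *_) f[x²]≡d ⟩
        c⁻¹ * d                               ≡⟨ c⁻¹d≡z ⟩
        z                                     ∎)) , +-identityʳ z

    backward : ∀ z → Σ Carrier (λ d → D h F b d × d + 0# ≡ z) → Σ Carrier (λ d → D h F a d × c⁻¹ * d ≡ z)
    backward z (d , (w , w≢0 , f[w²]≡d) , d+0≡z) =
      f h F a ((μ * w) ^ 2) , (μ * w , x*y≢0 μ≢0 w≢0 , refl) , (begin
        c⁻¹ * f h F a ((μ * w) ^ 2)  ≡⟨ cong (c⁻¹ *_) (f[[μw]²]≡c*f[w²] w) ⟩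
        c⁻¹ * (c * f h F b (w ^ 2))  ≡⟨ x⁻¹*[x*y]≡y c≢0 _ ⟩
        f h F b (w ^ 2)              ≡⟨ f[w²]≡d ⟩
        d                            ≡⟨ +-identityʳ d ⟨
        d + 0#                       ≡⟨ d+0≡z ⟩
        z                            ∎)

  D[s*[μ²]^[α+1]]∼D[s] : ∀ s {μ} → μ ≢ 0# → Equivalent (D h F (s * (μ ^ 2) ^ suc α)) (D h F s)
  D[s*[μ²]^[α+1]]∼D[s] s {μ} μ≢0 =
    D-equivalent-by-scaling μ≢0 (x^n≢0 (2 ℕ.* α ℕ.+ 3) (x^n≢0 2 μ≢0)) (f-scaling s (μ ^ 2))

  a≡±[μ²]^[α+1] : ∀ {a} → a ≢ 0# →
                  ∃₂ λ s μ → (s ≡ 1# ⊎ s ≡ - 1#) × μ ≢ 0# × a ≡ s * (μ ^ 2) ^ suc α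
  a≡±[μ²]^[α+1] {a} a≢0 = decompose (2[α′+1]-invertible h k (proj₂ (q′≡4k+3 h)))
    where
    s = a ^ n
    t = s * a

    s²≡1 : s * s ≡ 1#
    s²≡1 = trans (sym (^-homo-* a n n)) (fermat q′≡1+[n+n] a≢0)

    t≢0 : t ≢ 0#
    t≢0 = x*y≢0 (x^n≢0 n a≢0) a≢0

    tⁿ≡1 : t ^ n ≡ 1#
    tⁿ≡1 = begin
      (s * a) ^ n    ≡⟨ ^-distrib-* s a n ⟩
      s ^ n * a ^ n  ≡⟨ cong (_* s) (x^n≡1⇒x^[1+nj]≡x 2 (trans (cong (s *_) (*-identityʳ s)) s²≡1) k) ⟩
      s * s          ≡⟨ s²≡1 ⟩
      1#             ∎

    decompose : (∃₂ λ e j → e ℕ.* (2 ℕ.* suc α) ≡ suc (n ℕ.* j)) →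
                ∃₂ λ s μ → (s ≡ 1# ⊎ s ≡ - 1#) × μ ≢ 0# × a ≡ s * (μ ^ 2) ^ suc α
    decompose (e , j , e*2[α+1]≡1+nj) = s , t ^ e , x²≡1⇒x≡±1 s²≡1 , x^n≢0 e t≢0 , (begin
      a                          ≡⟨ *-identityˡ a ⟨
      1# * a                     ≡⟨ cong (_* a) s²≡1 ⟨
      s * s * a                  ≡⟨ *-assoc s s a ⟩
      s * t                      ≡⟨ cong (s *_) [[tᵉ]²]^[α+1]≡t ⟨
      s * ((t ^ e) ^ 2) ^ suc α  ∎)
      where
      [[tᵉ]²]^[α+1]≡t : ((t ^ e) ^ 2) ^ suc α ≡ t
      [[tᵉ]²]^[α+1]≡t = begin
        ((t ^ e) ^ 2) ^ suc α      ≡⟨ ^-assocʳ (t ^ e) 2 (suc α) ⟩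
        (t ^ e) ^ (2 ℕ.* suc α)    ≡⟨ ^-assocʳ t e (2 ℕ.* suc α) ⟩
        t ^ (e ℕ.* (2 ℕ.* suc α))  ≡⟨ cong (t ^_) e*2[α+1]≡1+nj ⟩
        t ^ suc (n ℕ.* j)          ≡⟨ x^n≡1⇒x^[1+nj]≡x n tⁿ≡1 j ⟩
        t                          ∎

open Normalisation using (D[s*[μ²]^[α+1]]∼D[s]; a≡±[μ²]^[α+1])

proposition4p2 : (h : ℕ) (F : FiniteField (q′ h)) (a : FiniteField.Carrier F)
    → ¬ (a ≡ FiniteField.0# F)
    → FiniteField.Equivalent F (D h F a) (D h F (FiniteField.1# F))
      ⊎ FiniteField.Equivalent F (D h F a) (D h F (FiniteField.-_ F (FiniteField.1# F)))
proposition4p2 h F a a≢0 = case a≡±[μ²]^[α+1] h F a≢0 of λ where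
  (s , μ , inj₁ refl , μ≢0 , refl) → inj₁ (D[s*[μ²]^[α+1]]∼D[s] h F s μ≢0)
  (s , μ , inj₂ refl , μ≢0 , refl) → inj₂ (D[s*[μ²]^[α+1]]∼D[s] h F s μ≢0)
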